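{- Assume the jobs are numbered so that $r_1\le\ldots\le r_n$. Then any optimal (minimum makespan) schedule has makespan $T^*\ge\sum_{i=1}^n\beta^{n-i}r_i$.
   Context: Problem: a single machine must process a set $\mathcal{J}=\{1,\ldots,n\}$ of jobs non-preemptively, at most one job at a time. Job $i$ has a release time $r_i\ge 0$ and a fixed processing time $\alpha_i\ge 0$, and there is a common deterioration rate $\beta>0$. If job $i$ starts at time $s_i\ge r_i$, its processing time is $\alpha_i+\beta s_i$ and it completes at $C_i=(1+\beta)s_i+\alpha_i$. A schedule is feasible if jobs do not overlap and $s_i\ge r_i$; its makespan is $\max_i C_i$.
   Formalization: The release times $r_i$, fixed parts $\alpha_i$, the rate $\beta$ and the start times $s_i$, both of the optimal schedule and of every schedule it is compared with, are rational. -}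

module Defs where

open import Data.Nat using (ℕ; zero; suc; _∸_)
open import Data.Fin using (Fin; zero; suc; toℕ)
open import Data.Rational using (ℚ; 0ℚ; 1ℚ; _+_; _*_; _≤_; _⊔_)
open import Data.Sum using (_⊎_)
open import Data.Product using (_×_)
open import Relation.Binary.PropositionalEquality using (_≢_)

_^_ : ℚ → ℕ → ℚ
q ^ zero  = 1ℚ
q ^ suc k = q * (q ^ k)

Σ : (n : ℕ) → (Fin n → ℚ) → ℚ
Σ zero    f = 0ℚ
Σ (suc n) f = f zero + Σ n (λ i → f (suc i))

-- maximum over Fin n (0 for the empty instance; completion times are ≥ 0 anyway)
Max : (n : ℕ) → (Fin n → ℚ) → ℚ
Max zero    f = 0ℚ
Max (suc n) f = f zero ⊔ Max n (λ i → f (suc i))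

-- completion time of a job with fixed part α started at s, rate β
completion : (β α s : ℚ) → ℚ
completion β α s = (1ℚ + β) * s + α

Feasible : (n : ℕ) (r α : Fin n → ℚ) (β : ℚ) (s : Fin n → ℚ) → Set
Feasible n r α β s =
  (∀ i → r i ≤ s i) ×
  (∀ i j → i ≢ j → completion β (α i) (s i) ≤ s j ⊎ completion β (α j) (s j) ≤ s i)

makespan : (n : ℕ) (α : Fin n → ℚ) (β : ℚ) (s : Fin n → ℚ) → ℚ
makespan n α β s = Max n (λ i → completion β (α i) (s i))

Optimal : (n : ℕ) (r α : Fin n → ℚ) (β : ℚ) (s : Fin n → ℚ) → Set
Optimal n r α β s =
  Feasible n r α β s ×
  (∀ s′ → Feasible n r α β s′ → makespan n α β s ≤ makespan n α β s′)

-- Σ_{i=1}^n β^{n-i} r_i, with 0-based index k = i-1, so exponent n - (k+1)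
lowerBound : (n : ℕ) (r : Fin n → ℚ) (β : ℚ) → ℚ
lowerBound n r β = Σ n (λ k → (β ^ (n ∸ suc (toℕ k))) * r k)

{-# OPTIONS --safe #-}
-- Every feasible schedule, optimal or not, satisfies the bound; induct on n.
-- Let j be a job finishing last. Every other job completes by s_j (a job
-- that starts after C_j ≥ C_i would satisfy C_i ≤ s_i, which forces
-- C_i ≤ 0), so the remaining n - 1 jobs form a feasible schedule of
-- makespan at most s_j, and by induction (their release dates dominate
-- r_1, …, r_{n-1}) the bound for the first n - 1 releases is at most s_j.
-- Also r_n ≤ s_j. Horner's rule for the bound then gives
--   Σ β^{n-i} r_i = β Σ_{i<n} β^{n-1-i} r_i + r_n ≤ (1 + β) s_j ≤ C_j.
module Submission where

open import Defs
open import Data.Nat using (ℕ)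
open import Data.Fin using (Fin)
open import Data.Rational using (ℚ; 0ℚ; _≤_; _<_)
open import Data.Fin using () renaming (_≤_ to _≤ᶠ_)

import Data.Nat as ℕ
import Data.Nat.Properties as ℕ
open import Data.Fin using (zero; suc; toℕ; inject₁; fromℕ; punchIn) renaming (_≟_ to _≟ᶠ_)
open import Data.Fin.Properties using (toℕ-inject₁; punchIn-injective; punchInᵢ≢i; punchIn-mono-≤)
open import Data.Rational using (1ℚ; _+_; _*_; nonNegative; positive)
open import Data.Rational.Properties
open import Data.Rational.Solver using (module +-*-Solver)
open import Data.Product using (Σ-syntax; _,_)
open import Data.Sum using (inj₁; inj₂)
open import Function using (_∘_)
open import Relation.Binary.PropositionalEquality using (_≡_; _≢_; refl; sym; cong; module ≡-Reasoning)
open import Relation.Nullary using (yes; no)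

open +-*-Solver

p≤p+q : ∀ p {q} → 0ℚ ≤ q → p ≤ p + q
p≤p+q p 0≤q = ≤-trans (≤-reflexive (sym (+-identityʳ p))) (+-monoʳ-≤ p 0≤q)

nonNeg*nonNeg : ∀ {p q} → 0ℚ ≤ p → 0ℚ ≤ q → 0ℚ ≤ p * q
nonNeg*nonNeg {p} {q} 0≤p 0≤q =
  nonNegative⁻¹ _ {{nonNeg*nonNeg⇒nonNeg p {{nonNegative 0≤p}} q {{nonNegative 0≤q}}}}

^-nonNeg : ∀ {β} → 0ℚ ≤ β → ∀ k → 0ℚ ≤ β ^ k
^-nonNeg 0≤β ℕ.zero    = nonNegative⁻¹ 1ℚ
^-nonNeg 0≤β (ℕ.suc k) = nonNeg*nonNeg 0≤β (^-nonNeg 0≤β k)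

Σ-mono-≤ : ∀ n {f g : Fin n → ℚ} → (∀ i → f i ≤ g i) → Σ n f ≤ Σ n g
Σ-mono-≤ ℕ.zero    f≤g = ≤-refl
Σ-mono-≤ (ℕ.suc n) f≤g = +-mono-≤ (f≤g zero) (Σ-mono-≤ n (f≤g ∘ suc))

f≤Max : ∀ n (f : Fin n → ℚ) i → f i ≤ Max n f
f≤Max (ℕ.suc n) f zero    = p≤p⊔q _ _
f≤Max (ℕ.suc n) f (suc i) = p≤q⇒p≤r⊔q (f zero) (f≤Max n (f ∘ suc) i)

-- Max of the empty family is 0, hence the hypothesis 0 ≤ x.
Max-lub : ∀ n {f : Fin n → ℚ} {x} → 0ℚ ≤ x → (∀ i → f i ≤ x) → Max n f ≤ x
Max-lub ℕ.zero    0≤x f≤x = 0≤x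
Max-lub (ℕ.suc n) 0≤x f≤x = ⊔-lub (f≤x zero) (Max-lub n 0≤x (f≤x ∘ suc))

argmax : ∀ n (f : Fin (ℕ.suc n) → ℚ) → Σ[ j ∈ Fin (ℕ.suc n) ] (∀ i → f i ≤ f j)
argmax ℕ.zero    f = zero , λ { zero → ≤-refl }
argmax (ℕ.suc n) f with argmax n (f ∘ suc)
... | j , j-max with f zero ≤? f (suc j)
...   | yes f0≤fj = suc j , λ { zero → f0≤fj ; (suc i) → j-max i }
...   | no  f0≰fj = zero  , λ { zero → ≤-refl
                            ; (suc i) → ≤-trans (j-max i) (<⇒≤ (≰⇒> f0≰fj)) }

inject₁≤punchIn : ∀ {n} (j : Fin (ℕ.suc n)) (i : Fin n) → inject₁ i ≤ᶠ punchIn j i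
inject₁≤punchIn zero    i       = ℕ.≤-trans (ℕ.≤-reflexive (toℕ-inject₁ i)) (ℕ.n≤1+n _)
inject₁≤punchIn (suc j) zero    = ℕ.z≤n
inject₁≤punchIn (suc j) (suc i) = ℕ.s≤s (inject₁≤punchIn j i)

lowerBound-mono-≤ : ∀ n {r r′ : Fin n → ℚ} {β} → 0ℚ ≤ β → (∀ i → r i ≤ r′ i) →
                    lowerBound n r β ≤ lowerBound n r′ β
lowerBound-mono-≤ n {β = β} 0≤β r≤r′ = Σ-mono-≤ n λ k →
  let e = n ℕ.∸ ℕ.suc (toℕ k) in
  *-monoˡ-≤-nonNeg (β ^ e) {{nonNegative (^-nonNeg 0≤β e)}} (r≤r′ k)

lowerBound-horner : ∀ n (r : Fin (ℕ.suc n) → ℚ) β →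
  lowerBound (ℕ.suc n) r β ≡ β * lowerBound n (r ∘ inject₁) β + r (fromℕ n)
lowerBound-horner ℕ.zero r β =
  solve 2 (λ b x → con 1ℚ :* x :+ con 0ℚ := b :* con 0ℚ :+ x) refl β (r zero)
lowerBound-horner (ℕ.suc n) r β = begin
  β ^ ℕ.suc n * r zero + lowerBound (ℕ.suc n) (r ∘ suc) β
    ≡⟨ cong (β ^ ℕ.suc n * r zero +_) (lowerBound-horner n (r ∘ suc) β) ⟩
  β * β ^ n * r zero + (β * L + x)
    ≡⟨ solve 5 (λ b p y l x → b :* p :* y :+ (b :* l :+ x) := b :* (p :* y :+ l) :+ x)
               refl β (β ^ n) (r zero) L x ⟩
  β * (β ^ n * r zero + L) + x ∎
  where
  open ≡-Reasoning
  L x : ℚ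
  L = lowerBound n (r ∘ suc ∘ inject₁) β
  x = r (suc (fromℕ n))

completion≡start+delay : ∀ β α s → completion β α s ≡ s + (β * s + α)
completion≡start+delay β α s =
  solve 3 (λ b a s → (con 1ℚ :+ b) :* s :+ a := s :+ (b :* s :+ a)) refl β α s

start≤completion : ∀ {β α s} → 0ℚ ≤ β → 0ℚ ≤ α → 0ℚ ≤ s → s ≤ completion β α s
start≤completion {β} {α} {s} 0≤β 0≤α 0≤s =
  ≤-trans (p≤p+q s (+-mono-≤ (nonNeg*nonNeg 0≤β 0≤s) 0≤α))
          (≤-reflexive (sym (completion≡start+delay β α s)))

start<completion : ∀ {β α s} → 0ℚ < β → 0ℚ ≤ α → 0ℚ < s → s < completion β α s
start<completion {β} {α} {s} 0<β 0≤α 0<s = begin-strict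
  s                   ≡⟨ sym (+-identityʳ s) ⟩
  s + 0ℚ              <⟨ +-monoʳ-< s (+-mono-<-≤ 0<βs 0≤α) ⟩
  s + (β * s + α)     ≡⟨ sym (completion≡start+delay β α s) ⟩
  completion β α s    ∎
  where
  open ≤-Reasoning
  0<βs : 0ℚ < β * s
  0<βs = positive⁻¹ _ {{pos*pos⇒pos β {{positive 0<β}} s {{positive 0<s}}}}

completion≤start⇒start≤0 : ∀ {β α s} → 0ℚ < β → 0ℚ ≤ α →
                           completion β α s ≤ s → s ≤ 0ℚ
completion≤start⇒start≤0 0<β 0≤α C≤s =
  ≮⇒≥ λ 0<s → <-irrefl refl (<-≤-trans (start<completion 0<β 0≤α 0<s) C≤s)

Feasible-punchIn : ∀ n {r α : Fin (ℕ.suc n) → ℚ} {β s} (j : Fin (ℕ.suc n)) →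
  Feasible (ℕ.suc n) r α β s →
  Feasible n (r ∘ punchIn j) (α ∘ punchIn j) β (s ∘ punchIn j)
Feasible-punchIn n j (released , disjoint) =
  released ∘ punchIn j ,
  λ i k i≢k → disjoint (punchIn j i) (punchIn j k) (i≢k ∘ punchIn-injective j i k)

lastFinisher-othersCompleteBeforeStart :
  ∀ n {r α : Fin n → ℚ} {β s} → 0ℚ < β → (∀ i → 0ℚ ≤ α i) → Feasible n r α β s →
  ∀ {j} → 0ℚ ≤ s j → (∀ i → completion β (α i) (s i) ≤ completion β (α j) (s j)) →
  ∀ i → i ≢ j → completion β (α i) (s i) ≤ s j
lastFinisher-othersCompleteBeforeStart n {α = α} {β} {s} 0<β 0≤α (_ , disjoint)
                                       {j} 0≤sj j-last i i≢j with disjoint i j i≢j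
... | inj₁ Ci≤sj = Ci≤sj
... | inj₂ Cj≤si = begin
  completion β (α i) (s i)  ≤⟨ Ci≤si ⟩
  s i                       ≤⟨ completion≤start⇒start≤0 0<β (0≤α i) Ci≤si ⟩
  0ℚ                        ≤⟨ 0≤sj ⟩
  s j                       ∎
  where
  open ≤-Reasoning
  Ci≤si : completion β (α i) (s i) ≤ s i
  Ci≤si = ≤-trans (j-last i) Cj≤si

feasible⇒lowerBound≤makespan :
  ∀ n (r α : Fin n → ℚ) β →
  (∀ i → 0ℚ ≤ r i) → (∀ i → 0ℚ ≤ α i) → 0ℚ < β →
  (∀ i j → i ≤ᶠ j → r i ≤ r j) →
  ∀ s → Feasible n r α β s → lowerBound n r β ≤ makespan n α β s
feasible⇒lowerBound≤makespan ℕ.zero r α β _ _ _ _ s _ = ≤-refl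
feasible⇒lowerBound≤makespan (ℕ.suc m) r α β 0≤r 0≤α 0<β sorted s feasible@(released , _)
  with argmax m (λ i → completion β (α i) (s i))
... | j , j-last = begin
  lowerBound (ℕ.suc m) r β
    ≡⟨ lowerBound-horner m r β ⟩
  β * lowerBound m (r ∘ inject₁) β + r (fromℕ m)
    ≤⟨ +-mono-≤ (*-monoˡ-≤-nonNeg β {{nonNegative 0≤β}} earlier≤sj) last≤sj ⟩
  β * s j + s j
    ≡⟨ solve 2 (λ b x → b :* x :+ x := (con 1ℚ :+ b) :* x) refl β (s j) ⟩
  (1ℚ + β) * s j
    ≤⟨ p≤p+q _ (0≤α j) ⟩
  completion β (α j) (s j)
    ≤⟨ f≤Max (ℕ.suc m) (λ i → completion β (α i) (s i)) j ⟩
  makespan (ℕ.suc m) α β s ∎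
  where
  open ≤-Reasoning
  0≤β : 0ℚ ≤ β
  0≤β = <⇒≤ 0<β

  0≤s : ∀ i → 0ℚ ≤ s i
  0≤s i = ≤-trans (0≤r i) (released i)

  others≤sj : ∀ i → i ≢ j → completion β (α i) (s i) ≤ s j
  others≤sj = lastFinisher-othersCompleteBeforeStart (ℕ.suc m) 0<β 0≤α feasible (0≤s j) j-last

  earlier≤sj : lowerBound m (r ∘ inject₁) β ≤ s j
  earlier≤sj = begin
    lowerBound m (r ∘ inject₁) β
      ≤⟨ lowerBound-mono-≤ m 0≤β (λ i → sorted _ _ (inject₁≤punchIn j i)) ⟩
    lowerBound m (r ∘ punchIn j) β
      ≤⟨ feasible⇒lowerBound≤makespan m (r ∘ punchIn j) (α ∘ punchIn j) β
           (0≤r ∘ punchIn j) (0≤α ∘ punchIn j) 0<β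
           (λ i k i≤k → sorted _ _ (punchIn-mono-≤ j i k i≤k))
           (s ∘ punchIn j) (Feasible-punchIn m {r} {α} {β} {s} j feasible) ⟩
    makespan m (α ∘ punchIn j) β (s ∘ punchIn j)
      ≤⟨ Max-lub m (0≤s j) (λ i → others≤sj (punchIn j i) (punchInᵢ≢i j i)) ⟩
    s j ∎

  last≤sj : r (fromℕ m) ≤ s j
  last≤sj with fromℕ m ≟ᶠ j
  ... | yes refl  = released j
  ... | no  last≢j = begin
    r (fromℕ m)                                 ≤⟨ released (fromℕ m) ⟩
    s (fromℕ m)                                 ≤⟨ start≤completion 0≤β (0≤α _) (0≤s _) ⟩
    completion β (α (fromℕ m)) (s (fromℕ m))    ≤⟨ others≤sj (fromℕ m) last≢j ⟩
    s j                                         ∎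

lemma11 : (n : ℕ) (r α : Fin n → ℚ) (β : ℚ) →
    (∀ i → 0ℚ ≤ r i) → (∀ i → 0ℚ ≤ α i) → 0ℚ < β →
    (∀ i j → i ≤ᶠ j → r i ≤ r j) →
    (s : Fin n → ℚ) → Optimal n r α β s →
    lowerBound n r β ≤ makespan n α β s
lemma11 n r α β 0≤r 0≤α 0<β sorted s (feasible , _) =
  feasible⇒lowerBound≤makespan n r α β 0≤r 0≤α 0<β sorted s feasible
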